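{- (1) There exist contract automata $\mathcal{A}_1,\mathcal{A}_2,\mathcal{A}_3$ such that $(\mathcal{A}_1\otimes\mathcal{A}_2)\otimes\mathcal{A}_3\neq\mathcal{A}_1\otimes(\mathcal{A}_2\otimes\mathcal{A}_3)$. (2) For all contract automata $\mathcal{A}_1,\mathcal{A}_2,\mathcal{A}_3$, $(\mathcal{A}_1\boxtimes\mathcal{A}_2)\boxtimes\mathcal{A}_3=\mathcal{A}_1\boxtimes(\mathcal{A}_2\boxtimes\mathcal{A}_3)$.
   Context: Fix disjoint sets $\mathbb{R}$ (requests) and $\mathbb{O}$ (offers $\overline a$) and an idle symbol $\Box$; $\Sigma=\mathbb{R}\cup\mathbb{O}\cup\{\Box\}$, $co$ the involution swapping $a$ and $\overline a$ and fixing $\Box$. For $\vec v\in\Sigma^n$, $\vec v_{(i)}$ is its $i$-th entry and $\Box^k$ the vector of $k$ idle symbols. $\vec a\in\Sigma^n$ is a request (resp. offer) on $\alpha$ if $\vec a=\Box^{n_1}\alpha\Box^{n_2}$ with $\alpha\in\mathbb{R}$ (resp. $\mathbb{O}$), a match on $\alpha$ if $\vec a=\Box^{n_1}\alpha\Box^{n_2}co(\alpha)\Box^{n_3}$. $\vec a\bowtie\vec b$ iff $\vec a$ is a request or offer on some $\alpha$, and if it is an offer on $\alpha$ then $\vec b$ is a request on $co(\alpha)$, and if it is a request on $\alpha$ then $\vec b$ is an offer on $co(\alpha)$. A contract automaton (CA) of rank $n$ is $\langle Q,\vec q_0,A^r,A^o,T,F\rangle$, $Q=Q_1\times\cdots\times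 Q_n$ finite, $\vec q_0\in Q$, finite $A^r\subseteq\mathbb{R}$, $A^o\subseteq\mathbb{O}$, $F\subseteq Q$, $T\subseteq Q\times(A^r\cup A^o\cup\{\Box\})^n\times Q$ with every label a request, offer or match and $\vec a_{(i)}=\Box\Rightarrow\vec q_{(i)}=\vec q'_{(i)}$. A principal is a CA of rank 1 with $A^r\cap co(A^o)=\emptyset$. Standing assumption: every CA of rank $>1$ is obtained from principals using product and a-product. Product $\bigotimes_{i\in1..n}\mathcal{A}_i$ of CAs $\mathcal{A}_i=\langle Q_i,\vec q_{0i},A^r_i,A^o_i,T_i,F_i\rangle$ of ranks $r_i$: rank $m=\sum r_i$, states $Q_1\times\cdots\times Q_n$ written $\vec q_1\ldots\vec q_n$, initial $\vec q_{01}\ldots\vec q_{0n}$, $A^r=\bigcup A^r_i$, $A^o=\bigcup A^o_i$, final states $\{\vec q_1\ldots\vec q_n\mid\vec q_i\in F_i\}$, and $(\vec q_1\ldots\vec q_n,\vec c,\vec q')$ is a transition iff either (i) for some $i<j$, $(\vec q_i,\vec a_i,\vec q_i')\in T_i$, $(\vec q_j,\vec a_j,\vec q_j')\in T_j$, $\vec a_i\bowtie\vec a_j$, $\vec c=\Box^u\vec a_i\Box^v\vec a_j\Box^z$ with $u=r_1+..+r_{i-1}$, $v=r_{i+1}+..+r_{j-1}$, $|\vec c|=m$, and $\vec q'$ replaces $\vec q_i,\vec q_j$ by $\vec q_i',\vec q_j'$; or (ii) for some $i$, $(\vec q_i,\vec a_i,\vec q_i')\in T_i$, $\vec c=\Box^u\vec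 a_i\Box^v$ with $u=r_1+..+r_{i-1}$, $v=r_{i+1}+..+r_n$, $\vec q'$ replaces $\vec q_i$ by $\vec q_i'$, and there is no $j\ne i$ and $(\vec q_j,\vec a_j,\vec q_j')\in T_j$ with $\vec a_i\bowtie\vec a_j$. $\mathcal{A}\otimes\mathcal{B}$ denotes the binary product. Projection $\prod^i(\mathcal{A})$ of a CA onto its $i$-th component: states $\{\vec q_{(i)}\}$, initial $\vec q_{0(i)}$, final $\{\vec q_{(i)}\mid\vec q\in F\}$, transitions $\{(\vec q_{(i)},\vec a_{(i)},\vec q'_{(i)})\mid(\vec q,\vec a,\vec q')\in T,\vec a_{(i)}\neq\Box\}$, and the requests/offers occurring in these transitions. a-Product: for CAs $\mathcal{A}_1,\mathcal{A}_2$ of ranks $n,m$, $\mathcal{A}_1\boxtimes\mathcal{A}_2=\bigotimes_{\mathcal{A}_i\in I}\mathcal{A}_i$ where $I=\{\prod^i(\mathcal{A}_1)\mid 0<i\le n\}\cup\{\prod^j(\mathcal{A}_2)\mid 0<j\le m\}$. -}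

module Defs where

open import Data.Nat using (ℕ; zero; suc; _+_; _≤_; _<_)
open import Data.Fin as Fin using (Fin; toℕ; splitAt)
open import Data.List using (List; []; _∷_; _++_; replicate; length; [_])
open import Data.List.Membership.Propositional using (_∈_)
open import Data.List.Relation.Unary.All using (All)
open import Data.Vec.Functional using (Vector; updateAt)
open import Data.Product using (Σ; Σ-syntax; _×_; _,_)
open import Data.Sum using (_⊎_; [_,_]′)
open import Data.Empty using (⊥)
open import Data.Unit using (⊤)
open import Relation.Nullary using (¬_)
open import Relation.Binary.PropositionalEquality using (_≡_; _≢_)
open import Function.Bundles using (_⇔_)

-- Alphabet.  Requests are  req a , offers are  off a  (= ā), idle is □.
-- Names of actions and local (component) states are natural numbers.

Name : Set
Name = ℕ

Loc : Set
Loc = ℕ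

data Sym : Set where
  req  : Name → Sym
  off  : Name → Sym
  idle : Sym

co : Sym → Sym
co (req a) = off a
co (off a) = req a
co idle    = idle

IsReqSym : Sym → Set
IsReqSym s = Σ Name λ a → s ≡ req a

IsOffSym : Sym → Set
IsOffSym s = Σ Name λ a → s ≡ off a

□^ : ℕ → List Sym
□^ k = replicate k idle

-- i-th entry (0-based) of a vector; the default is only used out of range
at : {A : Set} → A → List A → ℕ → A
at d []       _       = d
at d (x ∷ xs) zero    = x
at d (x ∷ xs) (suc i) = at d xs i

SoleAt : List Sym → Sym → Set
SoleAt v α = Σ ℕ λ n1 → Σ ℕ λ n2 → v ≡ □^ n1 ++ α ∷ □^ n2

RequestOn : List Sym → Sym → Set
RequestOn v α = IsReqSym α × SoleAt v α

OfferOn : List Sym → Sym → Set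
OfferOn v α = IsOffSym α × SoleAt v α

MatchOn : List Sym → Sym → Set
MatchOn v α = (IsReqSym α ⊎ IsOffSym α) ×
  (Σ ℕ λ n1 → Σ ℕ λ n2 → Σ ℕ λ n3 → v ≡ □^ n1 ++ α ∷ □^ n2 ++ co α ∷ □^ n3)

IsRequest IsOffer IsMatch : List Sym → Set
IsRequest v = Σ Sym λ α → RequestOn v α
IsOffer   v = Σ Sym λ α → OfferOn v α
IsMatch   v = Σ Sym λ α → MatchOn v α

_⋈_ : List Sym → List Sym → Set
a ⋈ b = Σ Sym λ α → (RequestOn a α ⊎ OfferOn a α)
                  × (OfferOn a α → RequestOn b (co α))
                  × (RequestOn a α → OfferOn b (co α))

-- Contract automata (raw data).  A state of a rank-n CA is a vector of
-- n local states; sets are predicates.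

record CA : Set₁ where
  field
    rank : ℕ
    Q    : List Loc → Set
    q0   : List Loc
    Ar   : Name → Set            -- Ar a  :⇔  req a ∈ A^r
    Ao   : Name → Set            -- Ao a  :⇔  off a ∈ A^o
    T    : List Loc → List Sym → List Loc → Set
    F    : List Loc → Set
open CA public

-- Finite (constructively: finitely enumerable) sets
Finite : {X : Set} → (X → Set) → Set
Finite {X} P = Σ (List X) λ xs → ∀ x → P x ⇔ (x ∈ xs)

FiniteT : (List Loc → List Sym → List Loc → Set) → Set
FiniteT R = Σ (List (List Loc × List Sym × List Loc)) λ ts →
  ∀ q a q' → R q a q' ⇔ ((q , a , q') ∈ ts)

InAlph : CA → Sym → Set
InAlph A (req x) = Ar A x
InAlph A (off x) = Ao A x
InAlph A idle    = ⊤

record IsCA (A : CA) : Set₁ where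
  field
    rank-pos : 1 ≤ rank A
    Q-prod   : Σ (Fin (rank A) → Loc → Set) λ Qc → ∀ q →
                 Q A q ⇔ (length q ≡ rank A × (∀ k → Qc k (at 0 q (toℕ k))))
    Q-fin    : Finite (Q A)
    q0∈Q     : Q A (q0 A)
    Ar-fin   : Finite (Ar A)
    Ao-fin   : Finite (Ao A)
    F⊆Q      : ∀ q → F A q → Q A q
    F-fin    : Finite (F A)
    T-fin    : FiniteT (T A)
    T-src    : ∀ q a q' → T A q a q' → Q A q
    T-tgt    : ∀ q a q' → T A q a q' → Q A q'
    T-len    : ∀ q a q' → T A q a q' → length a ≡ rank A
    T-alph   : ∀ q a q' → T A q a q' → All (InAlph A) a
    T-kind   : ∀ q a q' → T A q a q' → IsRequest a ⊎ IsOffer a ⊎ IsMatch a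
    T-idle   : ∀ q a q' → T A q a q' → ∀ (k : Fin (rank A)) →
                 at idle a (toℕ k) ≡ idle → at 0 q (toℕ k) ≡ at 0 q' (toℕ k)

IsPrincipal : CA → Set₁
IsPrincipal A = IsCA A × rank A ≡ 1 × (∀ x → Ar A x → Ao A x → ⊥)

flatten : {X : Set} {n : ℕ} → Vector (List X) n → List X
flatten {n = zero}  v = []
flatten {n = suc n} v = v Fin.zero ++ flatten (λ k → v (Fin.suc k))

sumV : {n : ℕ} → Vector ℕ n → ℕ
sumV {zero}  v = 0
sumV {suc n} v = v Fin.zero + sumV (λ k → v (Fin.suc k))

set : {X : Set} {n : ℕ} → Vector X n → Fin n → X → Vector X n
set v i x = updateAt v i (λ _ → x)

Decomp : {n : ℕ} → (Fin n → CA) → List Loc → Vector (List Loc) n → Set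
Decomp As q qs = (∀ k → length (qs k) ≡ rank (As k)) × q ≡ flatten qs

idles : {n : ℕ} → (Fin n → CA) → Vector (List Sym) n
idles As k = □^ (rank (As k))

ProdT-i : {n : ℕ} → (Fin n → CA) → Vector (List Loc) n → List Sym → List Loc → Set
ProdT-i As qs c q' =
  Σ _ λ i → Σ _ λ j → (i Fin.< j) ×
  Σ (List Sym) λ ai → Σ (List Loc) λ qi' → Σ (List Sym) λ aj → Σ (List Loc) λ qj' →
    T (As i) (qs i) ai qi' × T (As j) (qs j) aj qj' × (ai ⋈ aj) ×
    (c ≡ flatten (set (set (idles As) i ai) j aj)) ×
    (q' ≡ flatten (set (set qs i qi') j qj'))

ProdT-ii : {n : ℕ} → (Fin n → CA) → Vector (List Loc) n → List Sym → List Loc → Set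
ProdT-ii As qs c q' =
  Σ _ λ i → Σ (List Sym) λ ai → Σ (List Loc) λ qi' →
    T (As i) (qs i) ai qi' ×
    (c ≡ flatten (set (idles As) i ai)) ×
    (q' ≡ flatten (set qs i qi')) ×
    ¬ (Σ _ λ j → j ≢ i × Σ (List Sym) λ aj → Σ (List Loc) λ qj' →
         T (As j) (qs j) aj qj' × (ai ⋈ aj))

⨂ : {n : ℕ} → (Fin n → CA) → CA
⨂ {n} As = record
  { rank = sumV (λ k → rank (As k))
  ; Q    = λ q → Σ (Vector (List Loc) n) λ qs → Decomp As q qs × (∀ k → Q (As k) (qs k))
  ; q0   = flatten (λ k → q0 (As k))
  ; Ar   = λ x → Σ (Fin n) λ k → Ar (As k) x
  ; Ao   = λ x → Σ (Fin n) λ k → Ao (As k) x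
  ; T    = λ q c q' → Σ (Vector (List Loc) n) λ qs → Decomp As q qs ×
                        (∀ k → Q (As k) (qs k)) × (ProdT-i As qs c q' ⊎ ProdT-ii As qs c q')
  ; F    = λ q → Σ (Vector (List Loc) n) λ qs → Decomp As q qs × (∀ k → F (As k) (qs k))
  }

pair : CA → CA → Fin 2 → CA
pair A B Fin.zero       = A
pair A B (Fin.suc _)    = B

_⊗_ : CA → CA → CA
A ⊗ B = ⨂ (pair A B)

-- Projection Π^i (0-based index i) and a-product

Π : ℕ → CA → CA
Π i A = record
  { rank = 1
  ; Q    = λ v → Σ (List Loc) λ q → Q A q × v ≡ [ at 0 q i ]
  ; q0   = [ at 0 (q0 A) i ]
  ; Ar   = λ x → Σ (List Loc) λ q → Σ (List Sym) λ a → Σ (List Loc) λ q' →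
                   T A q a q' × at idle a i ≡ req x
  ; Ao   = λ x → Σ (List Loc) λ q → Σ (List Sym) λ a → Σ (List Loc) λ q' →
                   T A q a q' × at idle a i ≡ off x
  ; T    = λ p b p' → Σ (List Loc) λ q → Σ (List Sym) λ a → Σ (List Loc) λ q' →
                   T A q a q' × at idle a i ≢ idle ×
                   p ≡ [ at 0 q i ] × b ≡ [ at idle a i ] × p' ≡ [ at 0 q' i ]
  ; F    = λ v → Σ (List Loc) λ q → F A q × v ≡ [ at 0 q i ]
  }

_⊠_ : CA → CA → CA
A ⊠ B = ⨂ {rank A + rank B} (λ k →
          [ (λ i → Π (toℕ i) A) , (λ j → Π (toℕ j) B) ]′ (splitAt (rank A) k))

record _≈_ (A B : CA) : Set where
  field
    rank-eq : rank A ≡ rank B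
    q0-eq   : q0 A ≡ q0 B
    Q-eq    : ∀ q → Q A q ⇔ Q B q
    Ar-eq   : ∀ x → Ar A x ⇔ Ar B x
    Ao-eq   : ∀ x → Ao A x ⇔ Ao B x
    T-eq    : ∀ q a q' → T A q a q' ⇔ T B q a q'
    F-eq    : ∀ q → F A q ⇔ F B q

-- Standing assumption: CAs of rank > 1 are obtained from principals
-- using product and a-product.

data Generated : CA → Set₁ where
  principal : ∀ {A} → IsPrincipal A → Generated A
  product   : ∀ {A} n (As : Fin n → CA) → 1 ≤ n →
              (∀ k → Generated (As k)) → A ≈ ⨂ As → Generated A
  aproduct  : ∀ {A B C} → Generated A → Generated B → C ≈ (A ⊠ B) → Generated C

ContractAutomaton : CA → Set₁
ContractAutomaton A = IsCA A × (1 < rank A → Generated A)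

-- (1) Let ō be a one-state automaton looping on an offer and r one looping on the
-- matching request.  In ō ⊗ (r ⊗ r) the second r cannot match the first, so it moves
-- alone inside r ⊗ r, and that move then synchronises with ō: the label is (ō, □, r).
-- In (ō ⊗ r) ⊗ r the offer is always absorbed by the first r inside ō ⊗ r, so this
-- label never occurs.
--
-- (2) For a product of rank-one automata Cs, the projection Π^k (⨂ Cs) is Cs k
-- again: every product transition moves component k, if at all, by a transition of
-- Cs k; conversely every transition of Cs k occurs in a product transition from a
-- global state completed by arbitrary states of the other components (matched if
-- some other component can match it, alone otherwise).  Final states are recovered
-- as well provided every component has one, which holds whenever the outer product
-- is in a final state.  Hence both bracketings of the a-product are the product of
-- the n₁ + n₂ + n₃ projections of A₁, A₂, A₃.

module Submission where

open import Defs
open import Data.Nat using (ℕ; zero; suc; _+_; _<_; z≤n; s≤s)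
open import Data.Nat.Properties using (+-assoc; +-cancelˡ-<; +-monoʳ-<; <-≤-trans; m≤m+n)
  renaming (_≟_ to _≟ℕ_)
open import Data.Fin as Fin using (Fin; toℕ; splitAt; fromℕ<)
open import Data.Fin.Patterns using (0F; 1F)
open import Data.Fin.Properties using (toℕ<n; toℕ-fromℕ<; any?) renaming (_≟_ to _≟ᶠ_; <-cmp to <-cmpᶠ)
open import Data.List using (List; []; _∷_; _++_; [_]; length)
open import Data.List.Properties using (∷-injectiveˡ; ∷-injectiveʳ; ≡-dec)
open import Data.List.Membership.Propositional using (find; lose)
open import Data.List.Relation.Unary.All using ([]; _∷_)
open import Data.List.Relation.Unary.Any as Any using (Any; here; there)
open import Data.Vec.Functional using (Vector)
open import Data.Vec.Functional.Properties using (updateAt-updates; updateAt-minimal)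
open import Data.Product using (Σ; _×_; _,_; proj₁; proj₂)
open import Data.Sum using (_⊎_; inj₁; inj₂; [_,_]′)
open import Data.Empty using (⊥-elim)
open import Data.Unit using (tt)
open import Relation.Nullary using (¬_; Dec; yes; no)
open import Relation.Nullary.Decidable using (_×-dec_; map′; ¬?)
open import Relation.Binary using (Setoid; DecidableEquality; tri<; tri≈; tri>)
open import Relation.Binary.PropositionalEquality
  using (_≡_; _≢_; refl; sym; trans; cong; cong₂; subst; subst₂; module ≡-Reasoning)
import Relation.Binary.Reasoning.Setoid as SetoidReasoning
open import Function.Bundles using (_⇔_; mk⇔; Equivalence)
import Function.Properties.Equivalence as ⇔
open Equivalence using (to; from)

IsAction : Sym → Set
IsAction x = IsReqSym x ⊎ IsOffSym x

isAction? : ∀ x → Dec (IsAction x)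
isAction? (req a) = yes (inj₁ (a , refl))
isAction? (off a) = yes (inj₂ (a , refl))
isAction? idle    = no λ { (inj₁ (_ , ())) ; (inj₂ (_ , ())) }

_≟ˢ_ : DecidableEquality Sym
req a ≟ˢ req b = map′ (cong req) (λ { refl → refl }) (a ≟ℕ b)
off a ≟ˢ off b = map′ (cong off) (λ { refl → refl }) (a ≟ℕ b)
idle  ≟ˢ idle  = yes refl
req _ ≟ˢ off _ = no λ ()
req _ ≟ˢ idle  = no λ ()
off _ ≟ˢ req _ = no λ ()
off _ ≟ˢ idle  = no λ ()
idle  ≟ˢ req _ = no λ ()
idle  ≟ˢ off _ = no λ ()

sole-singleton : ∀ {x α} n₁ n₂ → [ x ] ≡ □^ n₁ ++ α ∷ □^ n₂ → x ≡ α
sole-singleton zero           _ e = ∷-injectiveˡ e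
sole-singleton (suc zero)     _ e with () ← ∷-injectiveʳ e
sole-singleton (suc (suc n₁)) _ e with () ← ∷-injectiveʳ e

⋈-sym : ∀ {a b} → a ⋈ b → b ⋈ a
⋈-sym (req x , inj₁ ra , _ , r⇒o) = off x , inj₂ (r⇒o ra) , (λ _ → ra) , λ { ((_ , ()) , _) }
⋈-sym (off x , inj₂ oa , o⇒r , _) = req x , inj₁ (o⇒r oa) , (λ { ((_ , ()) , _) }) , λ _ → oa
⋈-sym (req x , inj₂ ((_ , ()) , _) , _)
⋈-sym (off x , inj₁ ((_ , ()) , _) , _)
⋈-sym (idle  , inj₁ ((_ , ()) , _) , _)
⋈-sym (idle  , inj₂ ((_ , ()) , _) , _)

⋈-singleton : ∀ x y → ([ x ] ⋈ [ y ]) ⇔ (IsAction x × y ≡ co x)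
⋈-singleton x y = mk⇔ sound complete
  where
  sound : [ x ] ⋈ [ y ] → IsAction x × y ≡ co x
  sound (α , inj₁ r@(isReq , n₁ , n₂ , e) , _ , r⇒o) with refl ← sole-singleton n₁ n₂ e
    with (_ , m₁ , m₂ , e') ← r⇒o r = inj₁ isReq , sole-singleton m₁ m₂ e'
  sound (α , inj₂ o@(isOff , n₁ , n₂ , e) , o⇒r , _) with refl ← sole-singleton n₁ n₂ e
    with (_ , m₁ , m₂ , e') ← o⇒r o = inj₂ isOff , sole-singleton m₁ m₂ e'
  complete : IsAction x × y ≡ co x → [ x ] ⋈ [ y ]
  complete (inj₁ (a , refl) , refl) = req a , inj₁ ((a , refl) , 0 , 0 , refl) ,
    (λ { ((_ , ()) , _) }) , (λ _ → (a , refl) , 0 , 0 , refl)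
  complete (inj₂ (a , refl) , refl) = off a , inj₂ ((a , refl) , 0 , 0 , refl) ,
    (λ _ → (a , refl) , 0 , 0 , refl) , (λ { ((_ , ()) , _) })

⋈-singleton? : ∀ x y → Dec ([ x ] ⋈ [ y ])
⋈-singleton? x y =
  map′ (from (⋈-singleton x y)) (to (⋈-singleton x y)) (isAction? x ×-dec (y ≟ˢ co x))

set-same : ∀ {X : Set} {n} (v : Vector X n) i x → set v i x i ≡ x
set-same v i x = updateAt-updates i v

set-other : ∀ {X : Set} {n} (v : Vector X n) i x {k} → k ≢ i → set v i x k ≡ v k
set-other v i x {k} k≢i = updateAt-minimal k i v k≢i

set-cong : ∀ {X : Set} {n} {v w : Vector X n} i x → (∀ k → v k ≡ w k) → ∀ k → set v i x k ≡ set w i x k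
set-cong {v = v} {w} i x v≗w k with k ≟ᶠ i
... | yes refl = trans (set-same v k x) (sym (set-same w k x))
... | no k≢i   = trans (set-other v i x k≢i) (trans (v≗w k) (sym (set-other w i x k≢i)))

flatten-cong : ∀ {X : Set} {n} {v w : Vector (List X) n} → (∀ k → v k ≡ w k) → flatten v ≡ flatten w
flatten-cong {n = zero}  v≗w = refl
flatten-cong {n = suc n} v≗w = cong₂ _++_ (v≗w Fin.zero) (flatten-cong (λ k → v≗w (Fin.suc k)))

sumV-cong : ∀ {n} {v w : Vector ℕ n} → (∀ k → v k ≡ w k) → sumV v ≡ sumV w
sumV-cong {zero}  v≗w = refl
sumV-cong {suc n} v≗w = cong₂ _+_ (v≗w Fin.zero) (sumV-cong (λ k → v≗w (Fin.suc k)))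

at-flatten : ∀ {X : Set} {n} (d : X) (v : Vector (List X) n) → (∀ j → length (v j) ≡ 1) →
             ∀ k → [ at d (flatten v) (toℕ k) ] ≡ v k
at-flatten {n = suc n} d v len Fin.zero with v Fin.zero | len Fin.zero
... | _ ∷ [] | refl = refl
at-flatten {n = suc n} d v len (Fin.suc k) with v Fin.zero | len Fin.zero
... | _ ∷ [] | refl = at-flatten d (λ j → v (Fin.suc j)) (λ j → len (Fin.suc j)) k

singleton-view : ∀ {X : Set} (v : List X) → length v ≡ 1 → Σ X λ x → v ≡ [ x ]
singleton-view (x ∷ []) refl = x , refl

set-preserves : ∀ {X : Set} {n} {P : Fin n → X → Set} {w : Vector X n} {k x} →
                (∀ j → P j (w j)) → P k x → ∀ j → P j (set w k x j)
set-preserves {P = P} {w} {k} {x} Pw Px j with j ≟ᶠ k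
... | yes refl = subst (P j) (sym (set-same w j x)) Px
... | no j≢k   = subst (P j) (sym (set-other w k x j≢k)) (Pw j)

extend : ∀ {X : Set} {n} {P : Fin n → X → Set} → (∀ j → Σ X (P j)) → ∀ {k x} → P k x →
         Σ (Vector X n) λ v → (∀ j → P j (v j)) × v k ≡ x
extend {P = P} base {k} {x} Px =
  set (λ j → proj₁ (base j)) k x , set-preserves {P = P} (λ j → proj₂ (base j)) Px , set-same _ k x

T-resp : ∀ {C p₁ p₂ b₁ b₂ p₁' p₂'} → p₁ ≡ p₂ → b₁ ≡ b₂ → p₁' ≡ p₂' →
         T C p₁ b₁ p₁' → T C p₂ b₂ p₂'
T-resp refl refl refl t = t

≈-refl : ∀ {A} → A ≈ A
≈-refl = record
  { rank-eq = refl ; q0-eq = refl ; Q-eq = λ _ → ⇔.refl ; Ar-eq = λ _ → ⇔.refl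
  ; Ao-eq = λ _ → ⇔.refl ; T-eq = λ _ _ _ → ⇔.refl ; F-eq = λ _ → ⇔.refl }

≈-sym : ∀ {A B} → A ≈ B → B ≈ A
≈-sym A≈B = record
  { rank-eq = sym rank-eq ; q0-eq = sym q0-eq ; Q-eq = λ q → ⇔.sym (Q-eq q)
  ; Ar-eq = λ x → ⇔.sym (Ar-eq x) ; Ao-eq = λ x → ⇔.sym (Ao-eq x)
  ; T-eq = λ q a q' → ⇔.sym (T-eq q a q') ; F-eq = λ q → ⇔.sym (F-eq q) }
  where open _≈_ A≈B

≈-trans : ∀ {A B C} → A ≈ B → B ≈ C → A ≈ C
≈-trans A≈B B≈C = record
  { rank-eq = trans AB.rank-eq BC.rank-eq ; q0-eq = trans AB.q0-eq BC.q0-eq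
  ; Q-eq = λ q → ⇔.trans (AB.Q-eq q) (BC.Q-eq q)
  ; Ar-eq = λ x → ⇔.trans (AB.Ar-eq x) (BC.Ar-eq x) ; Ao-eq = λ x → ⇔.trans (AB.Ao-eq x) (BC.Ao-eq x)
  ; T-eq = λ q a q' → ⇔.trans (AB.T-eq q a q') (BC.T-eq q a q')
  ; F-eq = λ q → ⇔.trans (AB.F-eq q) (BC.F-eq q) }
  where module AB = _≈_ A≈B
        module BC = _≈_ B≈C

≈-setoid : Setoid _ _
≈-setoid = record
  { Carrier = CA ; _≈_ = _≈_
  ; isEquivalence = record { refl = ≈-refl ; sym = ≈-sym ; trans = ≈-trans } }

HasFinal : CA → Set
HasFinal C = Σ (List Loc) (F C)

record _≈[_]_ (A : CA) (I : Set) (B : CA) : Set where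
  field
    rank-eq : rank A ≡ rank B
    q0-eq   : q0 A ≡ q0 B
    Q-eq    : ∀ q → Q A q ⇔ Q B q
    Ar-eq   : ∀ x → Ar A x ⇔ Ar B x
    Ao-eq   : ∀ x → Ao A x ⇔ Ao B x
    T-eq    : ∀ q a q' → T A q a q' ⇔ T B q a q'
    F⇒      : ∀ q → F A q → F B q
    F⇐      : I → ∀ q → F B q → F A q

≡⇒≈[] : ∀ {A B I} → A ≡ B → A ≈[ I ] B
≡⇒≈[] refl = record
  { rank-eq = refl ; q0-eq = refl ; Q-eq = λ _ → ⇔.refl ; Ar-eq = λ _ → ⇔.refl
  ; Ao-eq = λ _ → ⇔.refl ; T-eq = λ _ _ _ → ⇔.refl ; F⇒ = λ _ f → f ; F⇐ = λ _ _ f → f }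

≈[]-weaken : ∀ {A B I J} → (J → I) → A ≈[ I ] B → A ≈[ J ] B
≈[]-weaken J⇒I A≈B = record
  { rank-eq = rank-eq ; q0-eq = q0-eq ; Q-eq = Q-eq ; Ar-eq = Ar-eq ; Ao-eq = Ao-eq
  ; T-eq = T-eq ; F⇒ = F⇒ ; F⇐ = λ j → F⇐ (J⇒I j) }
  where open _≈[_]_ A≈B

module ⨂-transfer {n} {As Bs : Fin n → CA}
  (rank-eq : ∀ k → rank (As k) ≡ rank (Bs k))
  (Q⇒ : ∀ k q → Q (As k) q → Q (Bs k) q)
  (T-eq : ∀ k q a q' → T (As k) q a q' ⇔ T (Bs k) q a q') where

  idles-eq : ∀ k → idles As k ≡ idles Bs k
  idles-eq k = cong □^ (rank-eq k)

  decomp⇒ : ∀ {q qs} → Decomp As q qs → Decomp Bs q qs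
  decomp⇒ (len , q≡) = (λ k → trans (len k) (rank-eq k)) , q≡

  states⇒ : ∀ {qs : Vector (List Loc) n} → (∀ k → Q (As k) (qs k)) → ∀ k → Q (Bs k) (qs k)
  states⇒ qs∈Q k = Q⇒ k _ (qs∈Q k)

  match⇒ : ∀ {qs c q'} → ProdT-i As qs c q' → ProdT-i Bs qs c q'
  match⇒ (i , j , i<j , ai , qi' , aj , qj' , ti , tj , ai⋈aj , refl , q'≡) =
    i , j , i<j , ai , qi' , aj , qj' , to (T-eq i _ _ _) ti , to (T-eq j _ _ _) tj , ai⋈aj ,
    flatten-cong (set-cong j aj (set-cong i ai idles-eq)) , q'≡

  single⇒ : ∀ {qs c q'} → ProdT-ii As qs c q' → ProdT-ii Bs qs c q'
  single⇒ (i , ai , qi' , ti , refl , q'≡ , unmatched) =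
    i , ai , qi' , to (T-eq i _ _ _) ti , flatten-cong (set-cong i ai idles-eq) , q'≡ ,
    λ (j , j≢i , aj , qj' , tj , ai⋈aj) → unmatched (j , j≢i , aj , qj' , from (T-eq j _ _ _) tj , ai⋈aj)

  Q-⨂⇒ : ∀ {q} → Q (⨂ As) q → Q (⨂ Bs) q
  Q-⨂⇒ (qs , d , qs∈Q) = qs , decomp⇒ d , states⇒ qs∈Q

  T-⨂⇒ : ∀ {q c q'} → T (⨂ As) q c q' → T (⨂ Bs) q c q'
  T-⨂⇒ (qs , d , qs∈Q , inj₁ m) = qs , decomp⇒ d , states⇒ qs∈Q , inj₁ (match⇒ m)
  T-⨂⇒ (qs , d , qs∈Q , inj₂ s) = qs , decomp⇒ d , states⇒ qs∈Q , inj₂ (single⇒ s)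

⨂-cong : ∀ {n} {As Bs : Fin n → CA} → (∀ k → As k ≈[ (∀ j → HasFinal (Bs j)) ] Bs k) → ⨂ As ≈ ⨂ Bs
⨂-cong {As = As} {Bs} As≈Bs = record
  { rank-eq = sumV-cong (λ k → rank-eq (As≈Bs k))
  ; q0-eq   = flatten-cong (λ k → q0-eq (As≈Bs k))
  ; Q-eq    = λ _ → mk⇔ AB.Q-⨂⇒ BA.Q-⨂⇒
  ; Ar-eq   = λ x → mk⇔ (λ (k , a) → k , to (Ar-eq (As≈Bs k) x) a)
                        (λ (k , a) → k , from (Ar-eq (As≈Bs k) x) a)
  ; Ao-eq   = λ x → mk⇔ (λ (k , a) → k , to (Ao-eq (As≈Bs k) x) a)
                        (λ (k , a) → k , from (Ao-eq (As≈Bs k) x) a)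
  ; T-eq    = λ _ _ _ → mk⇔ AB.T-⨂⇒ BA.T-⨂⇒
  ; F-eq    = λ _ → mk⇔
      (λ (qs , d , final) → qs , AB.decomp⇒ d , λ k → F⇒ (As≈Bs k) _ (final k))
      (λ (qs , d , final) → qs , BA.decomp⇒ d , λ k → F⇐ (As≈Bs k) (λ j → qs j , final j) _ (final k))
  }
  where
  open _≈[_]_
  module AB = ⨂-transfer {As = As} {Bs} (λ k → rank-eq (As≈Bs k)) (λ k q → to (Q-eq (As≈Bs k) q))
                         (λ k → T-eq (As≈Bs k))
  module BA = ⨂-transfer {As = Bs} {As} (λ k → sym (rank-eq (As≈Bs k))) (λ k q → from (Q-eq (As≈Bs k) q))
                         (λ k q a q' → ⇔.sym (T-eq (As≈Bs k) q a q'))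

module _ {n} {Cs : Fin n → CA} {qs : Vector (List Loc) n} where

  LocalStep : Fin n → List Sym → List Loc → Set
  LocalStep k a q' = (a ≡ idles Cs k × q' ≡ qs k) ⊎ T (Cs k) (qs k) a q'

  LocalSteps : Vector (List Sym) n → Vector (List Loc) n → Set
  LocalSteps lbl tgt = ∀ k → LocalStep k (lbl k) (tgt k)

  CanMatch : Fin n → List Sym → Set
  CanMatch k a = Σ (Fin n) λ j → j ≢ k × Σ (List Sym) λ aj → Σ (List Loc) λ qj' →
                   T (Cs j) (qs j) aj qj' × a ⋈ aj

  idle-steps : LocalSteps (idles Cs) qs
  idle-steps k = inj₁ (refl , refl)

  set-steps : ∀ {lbl tgt i ai qi'} → LocalSteps lbl tgt → T (Cs i) (qs i) ai qi' →
              LocalSteps (set lbl i ai) (set tgt i qi')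
  set-steps {lbl} {tgt} {i} {ai} {qi'} steps ti k with k ≟ᶠ i
  ... | yes refl = inj₂ (subst₂ (T (Cs k) (qs k)) (sym (set-same lbl k ai)) (sym (set-same tgt k qi')) ti)
  ... | no k≢i   = subst₂ (LocalStep k) (sym (set-other lbl i ai k≢i)) (sym (set-other tgt i qi' k≢i)) (steps k)

  product-steps : ∀ {c q'} → ProdT-i Cs qs c q' ⊎ ProdT-ii Cs qs c q' →
                  Σ _ λ lbl → Σ _ λ tgt → c ≡ flatten lbl × q' ≡ flatten tgt × LocalSteps lbl tgt
  product-steps (inj₁ (_ , _ , _ , _ , _ , _ , _ , ti , tj , _ , c≡ , q'≡)) =
    _ , _ , c≡ , q'≡ , set-steps (set-steps idle-steps ti) tj
  product-steps (inj₂ (_ , _ , _ , ti , c≡ , q'≡ , _)) =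
    _ , _ , c≡ , q'≡ , set-steps idle-steps ti

  lift-step : ∀ {k ak qk'} → (∀ j → length (qs j) ≡ rank (Cs j)) → (∀ j → Q (Cs j) (qs j)) →
              T (Cs k) (qs k) ak qk' → Dec (CanMatch k ak) →
              Σ _ λ lbl → Σ _ λ tgt → T (⨂ Cs) (flatten qs) (flatten lbl) (flatten tgt) ×
                lbl k ≡ ak × tgt k ≡ qk' × LocalSteps lbl tgt
  lift-step {k} {ak} {qk'} len qs∈Q tk (no unmatched) =
    set (idles Cs) k ak , set qs k qk' ,
    (qs , (len , refl) , qs∈Q , inj₂ (k , ak , qk' , tk , refl , refl , unmatched)) ,
    set-same _ k ak , set-same qs k qk' , set-steps idle-steps tk
  lift-step {k} {ak} {qk'} len qs∈Q tk (yes (j , j≢k , aj , qj' , tj , ak⋈aj)) with <-cmpᶠ k j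
  ... | tri< k<j _ _ =
    set (set (idles Cs) k ak) j aj , set (set qs k qk') j qj' ,
    (qs , (len , refl) , qs∈Q , inj₁ (k , j , k<j , ak , qk' , aj , qj' , tk , tj , ak⋈aj , refl , refl)) ,
    trans (set-other _ j aj k≢j) (set-same _ k ak) , trans (set-other _ j qj' k≢j) (set-same qs k qk') ,
    set-steps (set-steps idle-steps tk) tj
    where k≢j = λ k≡j → j≢k (sym k≡j)
  ... | tri≈ _ k≡j _ = ⊥-elim (j≢k (sym k≡j))
  ... | tri> _ _ j<k =
    set (set (idles Cs) j aj) k ak , set (set qs j qj') k qk' ,
    (qs , (len , refl) , qs∈Q , inj₁ (j , k , j<k , aj , qj' , ak , qk' , tj , tk , ⋈-sym ak⋈aj , refl , refl)) ,
    set-same _ k ak , set-same _ k qk' , set-steps (set-steps idle-steps tj) tk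

-- Projections of a product of rank-one automata

Occurs : CA → Sym → Set
Occurs C σ = Σ (List Loc) λ p → Σ (List Loc) λ p' → T C p [ σ ] p'

Occurs-cong : ∀ {A B σ} → (∀ p b p' → T A p b p' ⇔ T B p b p') → Occurs A σ ⇔ Occurs B σ
Occurs-cong T-eq = mk⇔ (λ (p , p' , t) → p , p' , to (T-eq _ _ _) t)
                       (λ (p , p' , t) → p , p' , from (T-eq _ _ _) t)

Π-occurs : ∀ i X σ → σ ≢ idle →
           (Σ (List Loc) λ q → Σ (List Sym) λ a → Σ (List Loc) λ q' → T X q a q' × at idle a i ≡ σ) ⇔
           Occurs (Π i X) σ
Π-occurs i X σ σ≢idle = mk⇔
  (λ (q , a , q' , t , a≡σ) → [ at 0 q i ] , [ at 0 q' i ] , q , a , q' , t ,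
     (λ a≡idle → σ≢idle (trans (sym a≡σ) a≡idle)) , refl , cong [_] (sym a≡σ) , refl)
  (λ (_ , _ , q , a , q' , t , _ , _ , σ≡ , _) → q , a , q' , t , sym (∷-injectiveˡ σ≡))

record IsProjectionLike (C : CA) : Set where
  field
    rank≡1    : rank C ≡ 1
    q0∈Q      : Q C (q0 C)
    Q-single  : ∀ v → Q C v → length v ≡ 1
    F-single  : ∀ v → F C v → length v ≡ 1
    T-src     : ∀ p b p' → T C p b p' → Q C p
    T-tgt     : ∀ p b p' → T C p b p' → Q C p'
    T-label   : ∀ p b p' → T C p b p' → length b ≡ 1 × at idle b 0 ≢ idle
    Ar-occurs : ∀ x → Ar C x ⇔ Occurs C (req x)
    Ao-occurs : ∀ x → Ao C x ⇔ Occurs C (off x)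
    match?    : ∀ p x → Dec (Σ (List Sym) λ b → Σ (List Loc) λ p' → T C p b p' × [ x ] ⋈ b)

module _ {n} {Cs : Fin n → CA} (isProj : ∀ k → IsProjectionLike (Cs k)) where
  open IsProjectionLike

  idles-single : ∀ j → idles Cs j ≡ [ idle ]
  idles-single j = cong □^ (rank≡1 (isProj j))

  states-single : ∀ {qs : Vector (List Loc) n} → (∀ j → Q (Cs j) (qs j)) → ∀ j → length (qs j) ≡ 1
  states-single qs∈Q j = Q-single (isProj j) _ (qs∈Q j)

  single⇒rank : ∀ (qs : Vector (List Loc) n) → (∀ j → length (qs j) ≡ 1) →
                ∀ j → length (qs j) ≡ rank (Cs j)
  single⇒rank _ single j = trans (single j) (sym (rank≡1 (isProj j)))

  finals-single : ∀ {qs : Vector (List Loc) n} → (∀ j → F (Cs j) (qs j)) → ∀ j → length (qs j) ≡ 1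
  finals-single fin j = F-single (isProj j) _ (fin j)

  steps-single : ∀ {qs lbl tgt} → (∀ j → Q (Cs j) (qs j)) → LocalSteps {Cs = Cs} {qs} lbl tgt →
                 (∀ j → length (lbl j) ≡ 1) × (∀ j → length (tgt j) ≡ 1)
  steps-single qs∈Q steps = (λ j → proj₁ (lengths j)) , (λ j → proj₂ (lengths j))
    where
    lengths : ∀ j → _
    lengths j with steps j
    ... | inj₁ (lbl≡ , tgt≡) = trans (cong length lbl≡) (cong length (idles-single j)) ,
                              trans (cong length tgt≡) (states-single qs∈Q j)
    ... | inj₂ t = proj₁ (T-label (isProj j) _ _ _ t) , Q-single (isProj j) _ (T-tgt (isProj j) _ _ _ t)

  initial-states : ∀ j → Σ _ (Q (Cs j))
  initial-states j = q0 (Cs j) , q0∈Q (isProj j)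

  can-match? : ∀ qs k x → Dec (CanMatch {Cs = Cs} {qs} k [ x ])
  can-match? qs k x = any? (λ j → ¬? (j ≟ᶠ k) ×-dec match? (isProj j) (qs j) x)

  Π⨂-Q⇒ : ∀ k v → Q (Π (toℕ k) (⨂ Cs)) v → Q (Cs k) v
  Π⨂-Q⇒ k _ (_ , (qs , (_ , refl) , qs∈Q) , refl) =
    subst (Q (Cs k)) (sym (at-flatten 0 qs (states-single qs∈Q) k)) (qs∈Q k)

  Π⨂-Q⇐ : ∀ k v → Q (Cs k) v → Q (Π (toℕ k) (⨂ Cs)) v
  Π⨂-Q⇐ k v v∈Q with qs , qs∈Q , refl ← extend {P = λ j → Q (Cs j)} initial-states {k} {v} v∈Q =
    flatten qs , (qs , (single⇒rank qs (states-single qs∈Q) , refl) , qs∈Q) ,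
    sym (at-flatten 0 qs (states-single qs∈Q) k)

  Π⨂-T⇒ : ∀ k p b p' → T (Π (toℕ k) (⨂ Cs)) p b p' → T (Cs k) p b p'
  Π⨂-T⇒ k _ _ _ (_ , _ , _ , (qs , (_ , refl) , qs∈Q , move) , active , refl , refl , refl)
    with lbl , tgt , refl , refl , steps ← product-steps {Cs = Cs} move
    with single-lbl , single-tgt ← steps-single qs∈Q steps
    with steps k
  ... | inj₂ tk = T-resp {Cs k} (sym (at-flatten 0 qs (states-single qs∈Q) k))
                         (sym (at-flatten idle lbl single-lbl k)) (sym (at-flatten 0 tgt single-tgt k)) tk
  ... | inj₁ (lbl≡ , _) =
    ⊥-elim (active (∷-injectiveˡ (trans (at-flatten idle lbl single-lbl k) (trans lbl≡ (idles-single k)))))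

  Π⨂-T⇐ : ∀ k p b p' → T (Cs k) p b p' → T (Π (toℕ k) (⨂ Cs)) p b p'
  Π⨂-T⇐ k p b p' t
    with x , refl ← singleton-view b (proj₁ (T-label (isProj k) _ _ _ t))
    with qs , qs∈Q , refl ← extend {P = λ j → Q (Cs j)} initial-states {k} {p} (T-src (isProj k) _ _ _ t)
    with lbl , tgt , lifted , lbl≡ , refl , steps ←
           lift-step {Cs = Cs} {k = k} {qk' = p'} (single⇒rank qs (states-single qs∈Q)) qs∈Q t (can-match? qs k x)
    with single-lbl , single-tgt ← steps-single qs∈Q steps =
    let label≡ = trans (at-flatten idle lbl single-lbl k) lbl≡ in
    flatten qs , flatten lbl , flatten tgt , lifted ,
    (λ x≡idle → proj₂ (T-label (isProj k) _ _ _ t) (trans (sym (∷-injectiveˡ label≡)) x≡idle)) ,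
    sym (at-flatten 0 qs (states-single qs∈Q) k) , sym label≡ , sym (at-flatten 0 tgt single-tgt k)

  Π⨂-F⇒ : ∀ k v → F (Π (toℕ k) (⨂ Cs)) v → F (Cs k) v
  Π⨂-F⇒ k _ (_ , (qs , (_ , refl) , fin) , refl) =
    subst (F (Cs k)) (sym (at-flatten 0 qs (finals-single fin) k)) (fin k)

  Π⨂-F⇐ : (∀ j → HasFinal (Cs j)) → ∀ k v → F (Cs k) v → F (Π (toℕ k) (⨂ Cs)) v
  Π⨂-F⇐ finals k v v∈F with qs , fin , refl ← extend {P = λ j → F (Cs j)} finals {k} {v} v∈F =
    flatten qs , (qs , (single⇒rank qs (finals-single fin) , refl) , fin) ,
    sym (at-flatten 0 qs (finals-single fin) k)

  Π-⨂ : ∀ k → Π (toℕ k) (⨂ Cs) ≈[ (∀ j → HasFinal (Cs j)) ] Cs k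
  Π-⨂ k = record
    { rank-eq = sym (rank≡1 (isProj k))
    ; q0-eq   = at-flatten 0 (λ j → q0 (Cs j)) (λ j → Q-single (isProj j) _ (q0∈Q (isProj j))) k
    ; Q-eq    = λ v → mk⇔ (Π⨂-Q⇒ k v) (Π⨂-Q⇐ k v)
    ; Ar-eq   = λ x → ⇔.trans (Π-occurs (toℕ k) (⨂ Cs) (req x) λ ())
                              (⇔.trans (occurs-eq (req x)) (⇔.sym (Ar-occurs (isProj k) x)))
    ; Ao-eq   = λ x → ⇔.trans (Π-occurs (toℕ k) (⨂ Cs) (off x) λ ())
                              (⇔.trans (occurs-eq (off x)) (⇔.sym (Ao-occurs (isProj k) x)))
    ; T-eq    = T-eq
    ; F⇒      = Π⨂-F⇒ k
    ; F⇐      = λ finals → Π⨂-F⇐ finals k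
    }
    where
    T-eq : ∀ p b p' → T (Π (toℕ k) (⨂ Cs)) p b p' ⇔ T (Cs k) p b p'
    T-eq p b p' = mk⇔ (Π⨂-T⇒ k p b p') (Π⨂-T⇐ k p b p')
    occurs-eq : ∀ σ → Occurs (Π (toℕ k) (⨂ Cs)) σ ⇔ Occurs (Cs k) σ
    occurs-eq _ = Occurs-cong {Π (toℕ k) (⨂ Cs)} {Cs k} T-eq

Π-match? : ∀ A → FiniteT (T A) → ∀ i p x →
           Dec (Σ (List Sym) λ b → Σ (List Loc) λ p' → T (Π i A) p b p' × [ x ] ⋈ b)
Π-match? A (ts , ts-complete) i p x = map′ found unfound (Any.any? matching? ts)
  where
  Matching : List Loc × List Sym × List Loc → Set
  Matching (q , a , _) = at idle a i ≢ idle × p ≡ [ at 0 q i ] × [ x ] ⋈ [ at idle a i ]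

  matching? : ∀ t → Dec (Matching t)
  matching? (q , a , _) =
    ¬? (at idle a i ≟ˢ idle) ×-dec (≡-dec _≟ℕ_ p [ at 0 q i ] ×-dec ⋈-singleton? x (at idle a i))

  found : Any Matching ts → Σ (List Sym) λ b → Σ (List Loc) λ p' → T (Π i A) p b p' × [ x ] ⋈ b
  found m with (q , a , q') , t∈ts , active , p≡ , x⋈ ← find m =
    [ at idle a i ] , [ at 0 q' i ] ,
    (q , a , q' , from (ts-complete q a q') t∈ts , active , p≡ , refl , refl) , x⋈

  unfound : (Σ (List Sym) λ b → Σ (List Loc) λ p' → T (Π i A) p b p' × [ x ] ⋈ b) → Any Matching ts
  unfound (_ , _ , (q , a , q' , t , active , p≡ , refl , _) , x⋈) =
    lose (to (ts-complete q a q') t) (active , p≡ , x⋈)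

Π-projection-like : ∀ {A} → IsCA A → ∀ i → IsProjectionLike (Π i A)
Π-projection-like {A} ca i = record
  { rank≡1    = refl
  ; q0∈Q      = q0 A , IsCA.q0∈Q ca , refl
  ; Q-single  = λ { _ (_ , _ , refl) → refl }
  ; F-single  = λ { _ (_ , _ , refl) → refl }
  ; T-src     = λ { _ _ _ (q , a , q' , t , _ , refl , _) → q , IsCA.T-src ca q a q' t , refl }
  ; T-tgt     = λ { _ _ _ (q , a , q' , t , _ , _ , _ , refl) → q' , IsCA.T-tgt ca q a q' t , refl }
  ; T-label   = λ { _ _ _ (_ , _ , _ , _ , active , _ , refl , _) → refl , active }
  ; Ar-occurs = λ x → Π-occurs i A (req x) λ ()
  ; Ao-occurs = λ x → Π-occurs i A (off x) λ ()
  ; match?    = Π-match? A (IsCA.T-fin ca) i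
  }

-- The a-product as a product of an ℕ-indexed family

append : ℕ → (ℕ → CA) → (ℕ → CA) → ℕ → CA
append zero    f g t       = g t
append (suc n) f g zero    = f zero
append (suc n) f g (suc t) = append n (λ t → f (suc t)) g t

append-< : ∀ n f g {t} → t < n → append n f g t ≡ f t
append-< (suc n) f g {zero}  _         = refl
append-< (suc n) f g {suc t} (s≤s t<n) = append-< n (λ t → f (suc t)) g t<n

append-+ : ∀ n f g u → append n f g (n + u) ≡ g u
append-+ zero    f g u = refl
append-+ (suc n) f g u = append-+ n (λ t → f (suc t)) g u

append-assoc-< : ∀ n₁ n₂ f g h {t} → t < n₁ + n₂ → append n₁ f g t ≡ append n₁ f (append n₂ g h) t
append-assoc-< zero     n₂ f g h t<   = sym (append-< n₂ g h t<)
append-assoc-< (suc n₁) n₂ f g h {zero}  _        = refl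
append-assoc-< (suc n₁) n₂ f g h {suc t} (s≤s t<) = append-assoc-< n₁ n₂ (λ t → f (suc t)) g h t<

append-splitAt : ∀ n {m} f g (k : Fin (n + m)) →
                 [ (λ i → f (toℕ i)) , (λ j → g (toℕ j)) ]′ (splitAt n k) ≡ append n f g (toℕ k)
append-splitAt zero    f g k           = refl
append-splitAt (suc n) f g Fin.zero    = refl
append-splitAt (suc n) f g (Fin.suc k) with splitAt n k | append-splitAt n (λ t → f (suc t)) g k
... | inj₁ _ | e = e
... | inj₂ _ | e = e

append-elim : ∀ (P : ℕ → CA → Set) n f g → (∀ t → t < n → P t (f t)) → (∀ u → P (n + u) (g u)) →
              ∀ t → P t (append n f g t)
append-elim P zero    f g Pf Pg t       = Pg t
append-elim P (suc n) f g Pf Pg zero    = Pf zero (s≤s z≤n)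
append-elim P (suc n) f g Pf Pg (suc t) =
  append-elim (λ t → P (suc t)) n (λ t → f (suc t)) g (λ t t< → Pf (suc t) (s≤s t<)) Pg t

⨂ⁿ : ℕ → (ℕ → CA) → CA
⨂ⁿ n G = ⨂ {n} λ k → G (toℕ k)

FinalsBelow : ℕ → (ℕ → CA) → Set
FinalsBelow n G = ∀ u → u < n → HasFinal (G u)

⨂ⁿ-cong : ∀ {n G H} → (∀ t → t < n → G t ≈[ FinalsBelow n H ] H t) → ⨂ⁿ n G ≈ ⨂ⁿ n H
⨂ⁿ-cong {n} {G} {H} G≈H = ⨂-cong λ k → ≈[]-weaken all-below (G≈H (toℕ k) (toℕ<n k))
  where
  all-below : (∀ (j : Fin n) → HasFinal (H (toℕ j))) → FinalsBelow n H
  all-below finals u u< = subst (λ t → HasFinal (H t)) (toℕ-fromℕ< u<) (finals (fromℕ< u<))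

projections : CA → CA → ℕ → CA
projections A B = append (rank A) (λ i → Π i A) (λ j → Π j B)

⊠-factors : (A B : CA) → Fin (rank A + rank B) → CA
⊠-factors A B k = [ (λ i → Π (toℕ i) A) , (λ j → Π (toℕ j) B) ]′ (splitAt (rank A) {rank B} k)

⊠-factors≡projections : ∀ A B k → ⊠-factors A B k ≡ projections A B (toℕ k)
⊠-factors≡projections A B = append-splitAt (rank A) (λ i → Π i A) (λ j → Π j B)

⊠-factors-projection-like : ∀ {A B} → IsCA A → IsCA B → ∀ k → IsProjectionLike (⊠-factors A B k)
⊠-factors-projection-like {A} {B} caA caB k with splitAt (rank A) {rank B} k
... | inj₁ i = Π-projection-like caA (toℕ i)
... | inj₂ j = Π-projection-like caB (toℕ j)

⊠-as-⨂ⁿ : ∀ A B → (A ⊠ B) ≈ ⨂ⁿ (rank A + rank B) (projections A B)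
⊠-as-⨂ⁿ A B = ⨂-cong λ k → ≡⇒≈[] (⊠-factors≡projections A B k)

sumV-ones : ∀ n → sumV {n} (λ _ → 1) ≡ n
sumV-ones zero    = refl
sumV-ones (suc n) = cong suc (sumV-ones n)

rank-⊠ : ∀ {A B} → IsCA A → IsCA B → rank (A ⊠ B) ≡ rank A + rank B
rank-⊠ {A} {B} caA caB =
  trans (sumV-cong λ k → IsProjectionLike.rank≡1 (⊠-factors-projection-like caA caB k)) (sumV-ones _)

Π-⊠ : ∀ {A B} → IsCA A → IsCA B → ∀ t → t < rank A + rank B →
      Π t (A ⊠ B) ≈[ FinalsBelow (rank A + rank B) (projections A B) ] projections A B t
Π-⊠ {A} {B} caA caB t t< =
  subst₂ (λ X Y → X ≈[ FinalsBelow (rank A + rank B) (projections A B) ] Y)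
         (cong (λ s → Π s (A ⊠ B)) (toℕ-fromℕ< t<))
         (trans (⊠-factors≡projections A B k) (cong (projections A B) (toℕ-fromℕ< t<)))
    (≈[]-weaken finals-of-factors (Π-⨂ (⊠-factors-projection-like caA caB) k))
  where
  k = fromℕ< t<
  finals-of-factors : FinalsBelow (rank A + rank B) (projections A B) → ∀ j → HasFinal (⊠-factors A B j)
  finals-of-factors finals j =
    subst HasFinal (sym (⊠-factors≡projections A B j)) (finals (toℕ j) (toℕ<n j))

-- Associativity of the a-product

module _ {A₁ A₂ A₃} (ca₁ : IsCA A₁) (ca₂ : IsCA A₂) (ca₃ : IsCA A₃) where
  private
    n₁ = rank A₁
    n₂ = rank A₂
    n₃ = rank A₃
    R₁₂ = rank (A₁ ⊠ A₂)
    R₂₃ = rank (A₂ ⊠ A₃)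
    P₁ = λ i → Π i A₁
    P₂ = λ i → Π i A₂
    P₃ = λ i → Π i A₃

  projections₁₂₃ : ℕ → CA
  projections₁₂₃ = append n₁ P₁ (projections A₂ A₃)

  projections₁₂₃-third : ∀ u → projections₁₂₃ (R₁₂ + u) ≡ P₃ u
  projections₁₂₃-third u = begin
    projections₁₂₃ (R₁₂ + u)        ≡⟨ cong (λ t → projections₁₂₃ (t + u)) (rank-⊠ ca₁ ca₂) ⟩
    projections₁₂₃ (n₁ + n₂ + u)    ≡⟨ cong projections₁₂₃ (+-assoc n₁ n₂ u) ⟩
    projections₁₂₃ (n₁ + (n₂ + u))  ≡⟨ append-+ n₁ P₁ _ (n₂ + u) ⟩
    projections A₂ A₃ (n₂ + u)      ≡⟨ append-+ n₂ P₂ P₃ u ⟩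
    P₃ u                            ∎
    where open ≡-Reasoning

  left-agree : ∀ t → t < R₁₂ + n₃ →
               projections (A₁ ⊠ A₂) A₃ t ≈[ FinalsBelow (R₁₂ + n₃) projections₁₂₃ ] projections₁₂₃ t
  left-agree = append-elim (λ t X → t < R₁₂ + n₃ → X ≈[ _ ] projections₁₂₃ t) _ _ _
    (λ t t< _ → subst (_ ≈[ _ ]_) (append-assoc-< n₁ n₂ P₁ P₂ P₃ (below t<))
                      (≈[]-weaken finals₁₂ (Π-⊠ ca₁ ca₂ t (below t<))))
    (λ u _ → ≡⇒≈[] (sym (projections₁₂₃-third u)))
    where
    below : ∀ {t} → t < R₁₂ → t < n₁ + n₂
    below = subst (_ <_) (rank-⊠ ca₁ ca₂)
    finals₁₂ : FinalsBelow (R₁₂ + n₃) projections₁₂₃ → FinalsBelow (n₁ + n₂) (projections A₁ A₂)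
    finals₁₂ finals u u< = subst HasFinal (sym (append-assoc-< n₁ n₂ P₁ P₂ P₃ u<))
      (finals u (<-≤-trans (subst (_ <_) (sym (rank-⊠ ca₁ ca₂)) u<) (m≤m+n R₁₂ n₃)))

  right-agree : ∀ t → t < n₁ + R₂₃ →
                projections A₁ (A₂ ⊠ A₃) t ≈[ FinalsBelow (n₁ + R₂₃) projections₁₂₃ ] projections₁₂₃ t
  right-agree = append-elim (λ t X → t < n₁ + R₂₃ → X ≈[ _ ] projections₁₂₃ t) _ _ _
    (λ t t< _ → ≡⇒≈[] (sym (append-< n₁ P₁ _ t<)))
    (λ u n₁+u< → subst (_ ≈[ _ ]_) (sym (append-+ n₁ P₁ _ u))
                       (≈[]-weaken finals₂₃ (Π-⊠ ca₂ ca₃ u (below (+-cancelˡ-< n₁ _ _ n₁+u<)))))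
    where
    below : ∀ {u} → u < R₂₃ → u < n₂ + n₃
    below = subst (_ <_) (rank-⊠ ca₂ ca₃)
    finals₂₃ : FinalsBelow (n₁ + R₂₃) projections₁₂₃ → FinalsBelow (n₂ + n₃) (projections A₂ A₃)
    finals₂₃ finals u u< = subst HasFinal (append-+ n₁ P₁ _ u)
      (finals (n₁ + u) (+-monoʳ-< n₁ (subst (_ <_) (sym (rank-⊠ ca₂ ca₃)) u<)))

  ⊠-assoc : ((A₁ ⊠ A₂) ⊠ A₃) ≈ (A₁ ⊠ (A₂ ⊠ A₃))
  ⊠-assoc = begin
    (A₁ ⊠ A₂) ⊠ A₃                           ≈⟨ ⊠-as-⨂ⁿ (A₁ ⊠ A₂) A₃ ⟩
    ⨂ⁿ (R₁₂ + n₃) (projections (A₁ ⊠ A₂) A₃) ≈⟨ ⨂ⁿ-cong left-agree ⟩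
    ⨂ⁿ (R₁₂ + n₃) projections₁₂₃              ≡⟨ cong (λ n → ⨂ⁿ n projections₁₂₃) ranks≡ ⟩
    ⨂ⁿ (n₁ + R₂₃) projections₁₂₃              ≈⟨ ⨂ⁿ-cong right-agree ⟨
    ⨂ⁿ (n₁ + R₂₃) (projections A₁ (A₂ ⊠ A₃)) ≈⟨ ⊠-as-⨂ⁿ A₁ (A₂ ⊠ A₃) ⟨
    A₁ ⊠ (A₂ ⊠ A₃)                           ∎
    where
    open SetoidReasoning ≈-setoid
    ranks≡ : R₁₂ + n₃ ≡ n₁ + R₂₃
    ranks≡ = trans (cong (_+ n₃) (rank-⊠ ca₁ ca₂))
                   (trans (+-assoc n₁ n₂ n₃) (cong (n₁ +_) (sym (rank-⊠ ca₂ ca₃))))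

-- A counterexample to associativity of the product

loop : Sym → CA
loop σ = record
  { rank = 1
  ; Q    = _≡ [ 0 ]
  ; q0   = [ 0 ]
  ; Ar   = λ x → σ ≡ req x
  ; Ao   = λ x → σ ≡ off x
  ; T    = λ p b p' → p ≡ [ 0 ] × b ≡ [ σ ] × p' ≡ [ 0 ]
  ; F    = _≡ [ 0 ]
  }

singleton-finite : ∀ {X : Set} (x : X) → Finite (_≡ x)
singleton-finite x = [ x ] , λ _ → mk⇔ here λ { (here e) → e ; (there ()) }

req-finite : ∀ σ → Finite (λ x → σ ≡ req x)
req-finite (req a) = [ a ] , λ _ → mk⇔ (λ { refl → here refl }) λ { (here refl) → refl ; (there ()) }
req-finite (off a) = [] , λ _ → mk⇔ (λ ()) λ ()
req-finite idle    = [] , λ _ → mk⇔ (λ ()) λ ()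

off-finite : ∀ σ → Finite (λ x → σ ≡ off x)
off-finite (req a) = [] , λ _ → mk⇔ (λ ()) λ ()
off-finite (off a) = [ a ] , λ _ → mk⇔ (λ { refl → here refl }) λ { (here refl) → refl ; (there ()) }
off-finite idle    = [] , λ _ → mk⇔ (λ ()) λ ()

loop-alphabet : ∀ σ → InAlph (loop σ) σ
loop-alphabet (req a) = refl
loop-alphabet (off a) = refl
loop-alphabet idle    = tt

loop-IsCA : ∀ {σ} → IsAction σ → IsCA (loop σ)
loop-IsCA {σ} action = record
  { rank-pos = s≤s z≤n
  ; Q-prod   = (λ _ l → l ≡ 0) , λ q → mk⇔ (λ { refl → refl , λ { Fin.zero → refl } }) (local-zero q)
  ; Q-fin    = singleton-finite [ 0 ]
  ; q0∈Q     = refl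
  ; Ar-fin   = req-finite σ
  ; Ao-fin   = off-finite σ
  ; F⊆Q      = λ _ q∈F → q∈F
  ; F-fin    = singleton-finite [ 0 ]
  ; T-fin    = [ ([ 0 ] , [ σ ] , [ 0 ]) ] , λ _ _ _ →
                 mk⇔ (λ { (refl , refl , refl) → here refl }) λ { (here refl) → refl , refl , refl ; (there ()) }
  ; T-src    = λ _ _ _ → proj₁
  ; T-tgt    = λ _ _ _ t → proj₂ (proj₂ t)
  ; T-len    = λ { _ _ _ (_ , refl , _) → refl }
  ; T-alph   = λ { _ _ _ (_ , refl , _) → loop-alphabet σ ∷ [] }
  ; T-kind   = λ { _ _ _ (_ , refl , _) → kind action }
  ; T-idle   = λ { _ _ _ (refl , _ , refl) _ _ → refl }
  }
  where
  local-zero : ∀ q → length q ≡ 1 × (∀ (k : Fin 1) → at 0 q (toℕ k) ≡ 0) → q ≡ [ 0 ]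
  local-zero []          (() , _)
  local-zero (_ ∷ [])    (refl , zero-at) = cong [_] (zero-at Fin.zero)
  local-zero (_ ∷ _ ∷ _) (() , _)
  kind : IsAction σ → IsRequest [ σ ] ⊎ IsOffer [ σ ] ⊎ IsMatch [ σ ]
  kind (inj₁ isReq) = inj₁ (σ , isReq , 0 , 0 , refl)
  kind (inj₂ isOff) = inj₂ (inj₁ (σ , isOff , 0 , 0 , refl))

loop-ContractAutomaton : ∀ {σ} → IsAction σ → ContractAutomaton (loop σ)
loop-ContractAutomaton action = loop-IsCA action , λ { (s≤s ()) }

offer request : CA
offer   = loop (off 0)
request = loop (req 0)

offer-ContractAutomaton : ContractAutomaton offer
offer-ContractAutomaton = loop-ContractAutomaton (inj₂ (0 , refl))

request-ContractAutomaton : ContractAutomaton request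
request-ContractAutomaton = loop-ContractAutomaton (inj₁ (0 , refl))

zeros : List Loc
zeros = 0 ∷ 0 ∷ 0 ∷ []

offer-□-request : List Sym
offer-□-request = off 0 ∷ idle ∷ req 0 ∷ []

off⋈req : [ off 0 ] ⋈ [ req 0 ]
off⋈req = from (⋈-singleton (off 0) (req 0)) (inj₂ (0 , refl) , refl)

req⋈̸req : ¬ ([ req 0 ] ⋈ [ req 0 ])
req⋈̸req req⋈req with () ← proj₂ (to (⋈-singleton (req 0) (req 0)) req⋈req)

offer⊗request-labels : ∀ {p a p'} → T (offer ⊗ request) p a p' →
                       a ≡ off 0 ∷ req 0 ∷ [] ⊎ a ≡ idle ∷ req 0 ∷ []
offer⊗request-labels (_ , _ , _ , inj₁ (0F , 1F , _ , _ , _ , _ , _ , (_ , refl , _) , (_ , refl , _) , _ , refl , _)) =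
  inj₁ refl
offer⊗request-labels (_ , _ , _ , inj₁ (0F , 0F , () , _))
offer⊗request-labels (_ , _ , _ , inj₁ (1F , 0F , () , _))
offer⊗request-labels (_ , _ , _ , inj₁ (1F , 1F , s≤s () , _))
offer⊗request-labels (_ , _ , qs∈Q , inj₂ (0F , _ , _ , (_ , refl , _) , refl , _ , unmatched)) =
  ⊥-elim (unmatched (1F , (λ ()) , [ req 0 ] , [ 0 ] , (qs∈Q 1F , refl , refl) , off⋈req))
offer⊗request-labels (_ , _ , _ , inj₂ (1F , _ , _ , (_ , refl , _) , refl , _ , _)) = inj₂ refl

¬offer-meets-last-request : ¬ T ((offer ⊗ request) ⊗ request) zeros offer-□-request zeros
¬offer-meets-last-request (_ , _ , _ , inj₁ (0F , 1F , _ , _ , _ , _ , _ , t₁₂ , (_ , refl , _) , _ , c≡ , _))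
  with offer⊗request-labels t₁₂ | c≡
... | inj₁ refl | ()
... | inj₂ refl | ()
¬offer-meets-last-request (_ , _ , _ , inj₁ (0F , 0F , () , _))
¬offer-meets-last-request (_ , _ , _ , inj₁ (1F , 0F , () , _))
¬offer-meets-last-request (_ , _ , _ , inj₁ (1F , 1F , s≤s () , _))
¬offer-meets-last-request (_ , _ , _ , inj₂ (0F , _ , _ , t₁₂ , c≡ , _ , _)) with offer⊗request-labels t₁₂ | c≡
... | inj₁ refl | ()
... | inj₂ refl | ()
¬offer-meets-last-request (_ , _ , _ , inj₂ (1F , _ , _ , _ , () , _ , _))

offer-meets-last-request : T (offer ⊗ (request ⊗ request)) zeros offer-□-request zeros
offer-meets-last-request =
  outer , (outer-ranks , refl) , (λ { 0F → refl ; 1F → requests-state }) ,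
  inj₁ (0F , 1F , s≤s z≤n , [ off 0 ] , [ 0 ] , idle ∷ req 0 ∷ [] , 0 ∷ 0 ∷ [] ,
        (refl , refl , refl) , last-request , meets , refl , refl)
  where
  outer : Vector (List Loc) 2
  outer 0F = [ 0 ]
  outer 1F = 0 ∷ 0 ∷ []
  outer-ranks : ∀ k → length (outer k) ≡ rank (pair offer (request ⊗ request) k)
  outer-ranks = λ { 0F → refl ; 1F → refl }
  inner : Vector (List Loc) 2
  inner _ = [ 0 ]
  inner-ranks : ∀ k → length (inner k) ≡ rank (pair request request k)
  inner-ranks = λ { 0F → refl ; 1F → refl }
  inner-states : ∀ k → Q (pair request request k) (inner k)
  inner-states = λ { 0F → refl ; 1F → refl }
  requests-state : Q (request ⊗ request) (0 ∷ 0 ∷ [])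
  requests-state = inner , (inner-ranks , refl) , inner-states
  last-request : T (request ⊗ request) (0 ∷ 0 ∷ []) (idle ∷ req 0 ∷ []) (0 ∷ 0 ∷ [])
  last-request = inner , (inner-ranks , refl) , inner-states ,
    inj₂ (1F , [ req 0 ] , [ 0 ] , (refl , refl , refl) , refl , refl ,
      λ { (0F , _ , _ , _ , (_ , refl , _) , req⋈req) → req⋈̸req req⋈req ; (1F , j≢k , _) → j≢k refl })
  meets : [ off 0 ] ⋈ (idle ∷ req 0 ∷ [])
  meets = off 0 , inj₂ ((0 , refl) , 0 , 0 , refl) , (λ _ → (0 , refl) , 1 , 0 , refl) , λ { ((_ , ()) , _) }

⊗-not-associative : ¬ (((offer ⊗ request) ⊗ request) ≈ (offer ⊗ (request ⊗ request)))
⊗-not-associative assoc =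
  ¬offer-meets-last-request (from (_≈_.T-eq assoc zeros offer-□-request zeros) offer-meets-last-request)

proposition2p10 :
    (Σ CA λ A₁ → Σ CA λ A₂ → Σ CA λ A₃ →
       ContractAutomaton A₁ × ContractAutomaton A₂ × ContractAutomaton A₃ ×
       ¬ (((A₁ ⊗ A₂) ⊗ A₃) ≈ (A₁ ⊗ (A₂ ⊗ A₃))))
    ×
    (∀ A₁ A₂ A₃ → ContractAutomaton A₁ → ContractAutomaton A₂ → ContractAutomaton A₃ →
       ((A₁ ⊠ A₂) ⊠ A₃) ≈ (A₁ ⊠ (A₂ ⊠ A₃)))
proposition2p10 =
  ( offer , request , request
  , offer-ContractAutomaton , request-ContractAutomaton , request-ContractAutomaton
  , ⊗-not-associative) ,
  λ A₁ A₂ A₃ c₁ c₂ c₃ → ⊠-assoc {A₁} {A₂} {A₃} (proj₁ c₁) (proj₁ c₂) (proj₁ c₃)
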